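{- Let $G=(V,E)$ be a finite simple undirected graph with vertices $v_1,\dots,v_n$, of which $v_1,\dots,v_k$ are designated as leaves. For $1\le i,j\le n$ let $e_{ij}=i\cdot n^2+j\cdot n$, and write each edge as $(v_i,v_j)$ in a fixed orientation. Let $c_0,\dots,c_n$, $b$, and $\widetilde{c_{ij}}$ (one for each edge $(v_i,v_j)\in E$) be distinct variables. Let $A''_G$ be the quantifier-free symbolic heap $$(b=c_0+3)\wedge\bigwedge_{i=1}^{k}(c_0+1\le c_i\wedge c_i\le b)\ :\ \mathop{*}_{(v_i,v_j)\in E,\ \ell\in\{1,2,3\}} c_0+e_{ij}+\ell\mapsto\mathsf{nil},$$ and let $B''_G$ be the symbolic heap $$\exists\vec z.\ \bigwedge_{i=1}^{n}(c_0+1\le c_i\wedge c_i\le b)\wedge\bigwedge_{(v_i,v_j)\in E}(c_0+1\le\widetilde{c_{ij}}\wedge\widetilde{c_{ij}}\le b)\ :\ \mathop{*}_{(v_i,v_j)\in E}\big(c_i+e_{ij}\mapsto\mathsf{nil} * c_j+e_{ij}\mapsto\mathsf{nil} * \widetilde{c_{ij}}+e_{ij}\mapsto\mathsf{nil}\big),$$ where $\vec z$ consists of all variables occurring in $B''_G$ that do not occur in $A''_G$. Then $A''_G\models B''_G$ holds if and only if every assignment of colours from $\{1,2,3\}$ to the leaves $v_1,\dots,v_k$ can be extended to a $3$-colouring of all of $G$ in which no two adjacent vertices share the same colour.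
   Context: Minimal pointer arithmetic: terms $t ::= x \mid t+k$ ($x$ a variable, $k\in\mathbb{N}$); pure formulas $\Pi ::= t=t \mid t\le t \mid t<t \mid \Pi\wedge\Pi$; spatial formulas $F ::= \mathsf{emp}\mid t\mapsto\mathsf{nil}\mid F*F$; a symbolic heap is $\exists\vec z.\,\Pi:F$. Values are natural numbers or the non-addressable value $\mathit{nil}$. A stack $s$ maps variables to values, extended by $s(k)=k$, $s(t+k)=s(t)+k$, $s(\mathsf{nil})=\mathit{nil}$. A heap is a finite partial function from $\mathbb{N}$ to values; $h_1\circ h_2$ is the union of domain-disjoint heaps. $s,h\models t_1\sim t_2$ iff $s(t_1)\sim s(t_2)$; $\wedge$ as usual; $s,h\models\mathsf{emp}$ iff $h$ is empty; $s,h\models t\mapsto\mathsf{nil}$ iff $\mathrm{dom}(h)=\{s(t)\}$ and $h(s(t))=\mathit{nil}$; $s,h\models F_1*F_2$ iff $h=h_1\circ h_2$ with $s,h_1\models F_1$, $s,h_2\models F_2$; $s,h\models\exists\vec z.\,\Pi:F$ iff some $\vec m\in\mathbb{N}^{|\vec z|}$ has $s[\vec z\mapsto\vec m],h$ satisfying both $\Pi$ and $F$. Entailment $A\models B$ means every $(s,h)$ satisfying $A$ satisfies $B$. -}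

module Defs where

open import Data.Nat using (ℕ; zero; suc; _+_; _*_; _≤_; _<_)
open import Data.Fin using (Fin; toℕ)
open import Data.List using (List; []; _∷_; _++_; map; concatMap; foldr; upTo; drop)
open import Data.List.Membership.Propositional using (_∈_)
open import Data.List.Relation.Unary.All using (All)
open import Data.List.Relation.Unary.AllPairs using (AllPairs)
open import Data.Maybe using (Maybe; just; nothing)
open import Data.Product using (Σ; ∃; _×_; _,_; proj₁; proj₂)
open import Data.Sum using (_⊎_)
open import Relation.Binary.PropositionalEquality using (_≡_; _≢_)
open import Relation.Nullary using (¬_)

data Val : Set where
  num : ℕ → Val
  nil : Val

module Syntax (Var : Set) where

  infixl 8 _⊕_
  infix 6 _↦nil
  infixr 5 _✱_
  infix 4 _≐_ _≤ₚ_ _<ₚ_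
  data Term : Set where
    var : Var → Term
    _⊕_ : Term → ℕ → Term

  -- pure atoms; a pure formula is a conjunction, represented as a list
  data Atom : Set where
    _≐_  : Term → Term → Atom
    _≤ₚ_ : Term → Term → Atom
    _<ₚ_ : Term → Term → Atom

  Pure : Set
  Pure = List Atom

  data Spatial : Set where
    emp   : Spatial
    _↦nil : Term → Spatial
    _✱_   : Spatial → Spatial → Spatial

  ⊛ : List Spatial → Spatial
  ⊛ = foldr _✱_ emp

  record SH : Set where
    constructor ∃[_]_∶_
    field
      exVars  : List Var
      pure    : Pure
      spatial : Spatial

  Stack : Set
  Stack = Var → Val

  record Heap : Set where
    field
      fun    : ℕ → Maybe Val
      finite : ∃ λ N → ∀ a → N ≤ a → fun a ≡ nothing
  open Heap public

  Split : Heap → Heap → Heap → Set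
  Split h h₁ h₂ = ∀ a → (fun h a ≡ fun h₁ a × fun h₂ a ≡ nothing)
                      ⊎ (fun h a ≡ fun h₂ a × fun h₁ a ≡ nothing)

  -- evaluation of terms; nothing = undefined (nil + k is undefined)
  addV : Maybe Val → ℕ → Maybe Val
  addV (just (num m)) k = just (num (m + k))
  addV _              k = nothing

  eval : Stack → Term → Maybe Val
  eval s (var x) = just (s x)
  eval s (t ⊕ k) = addV (eval s t) k

  ⊨A : Stack → Atom → Set
  ⊨A s (t₁ ≐ t₂)  = ∃ λ v → eval s t₁ ≡ just v × eval s t₂ ≡ just v
  ⊨A s (t₁ ≤ₚ t₂) = Σ ℕ λ m → Σ ℕ λ n →
                      eval s t₁ ≡ just (num m) × eval s t₂ ≡ just (num n) × m ≤ n
  ⊨A s (t₁ <ₚ t₂) = Σ ℕ λ m → Σ ℕ λ n →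
                      eval s t₁ ≡ just (num m) × eval s t₂ ≡ just (num n) × m < n

  ⊨Π : Stack → Pure → Set
  ⊨Π s Π = All (⊨A s) Π

  ⊨F : Stack → Heap → Spatial → Set
  ⊨F s h emp       = ∀ a → fun h a ≡ nothing
  ⊨F s h (t ↦nil)  = Σ ℕ λ a → eval s t ≡ just (num a)
                       × fun h a ≡ just nil
                       × (∀ a′ → a′ ≢ a → fun h a′ ≡ nothing)
  ⊨F s h (F₁ ✱ F₂) = Σ Heap λ h₁ → Σ Heap λ h₂ →
                       Split h h₁ h₂ × ⊨F s h₁ F₁ × ⊨F s h₂ F₂

  -- s,h ⊨ ∃ z⃗. Π : F  iff some stack s′ = s[z⃗ ↦ m⃗] with m⃗ ∈ ℕ satisfies Π and F
  ⊨SH : Stack → Heap → SH → Set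
  ⊨SH s h (∃[ zs ] Π ∶ F) =
    Σ Stack λ s′ → (∀ x → ¬ (x ∈ zs) → s′ x ≡ s x)
                 × All (λ z → ∃ λ m → s′ z ≡ num m) zs
                 × ⊨Π s′ Π × ⊨F s′ h F

  _⊨_ : SH → SH → Set
  A ⊨ B = ∀ (s : Stack) (h : Heap) → ⊨SH s h A → ⊨SH s h B

-- variables c₀,…,cₙ , b , c̃ᵢⱼ (indices 1-based), pairwise distinct by construction
data GVar : Set where
  c  : ℕ → GVar
  b  : GVar
  c̃  : ℕ → ℕ → GVar

open Syntax GVar public

-- graph on vertices v₁..vₙ, given as Fin n (vertex i is v_{toℕ i + 1});
-- edges as a list of oriented pairs
Edges : ℕ → Set
Edges n = List (Fin n × Fin n)

Loopless : ∀ {n} → Edges n → Set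
Loopless es = All (λ e → proj₁ e ≢ proj₂ e) es

NoMultiEdges : ∀ {n} → Edges n → Set
NoMultiEdges es = AllPairs (λ e e′ → ¬ (proj₁ e ≡ proj₁ e′ × proj₂ e ≡ proj₂ e′)
                                   × ¬ (proj₁ e ≡ proj₂ e′ × proj₂ e ≡ proj₁ e′)) es

idx : ∀ {n} → Fin n → ℕ
idx i = suc (toℕ i)

eIdx : (n : ℕ) → Fin n → Fin n → ℕ
eIdx n i j = idx i * (n * n) + idx j * n

c₀ : Term
c₀ = var (c 0)

bounds : Term → List Atom
bounds t = ((c₀ ⊕ 1) ≤ₚ t) ∷ (t ≤ₚ var b) ∷ []

A″ : (n k : ℕ) → Edges n → SH
A″ n k es =
  ∃[ [] ] ((var b ≐ (c₀ ⊕ 3)) ∷ concatMap (λ i → bounds (var (c i))) (map suc (upTo k)))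
        ∶ ⊛ (concatMap (λ e → map (λ ℓ → ((c₀ ⊕ eIdx n (proj₁ e) (proj₂ e)) ⊕ ℓ) ↦nil)
                                   (1 ∷ 2 ∷ 3 ∷ []))
                        es)

-- z⃗ = variables of B″ not occurring in A″ : c_{k+1},…,c_n and all c̃ᵢⱼ
B″ : (n k : ℕ) → Edges n → SH
B″ n k es =
  ∃[ map c (drop k (map suc (upTo n))) ++ map (λ e → c̃ (idx (proj₁ e)) (idx (proj₂ e))) es ]
     (concatMap (λ i → bounds (var (c i))) (map suc (upTo n))
       ++ concatMap (λ e → bounds (var (c̃ (idx (proj₁ e)) (idx (proj₂ e))))) es)
   ∶ ⊛ (map (λ e → let i = proj₁ e ; j = proj₂ e ; eij = eIdx n i j in
                    ((var (c (idx i)) ⊕ eij) ↦nil ✱ (var (c (idx j)) ⊕ eij) ↦nil)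
                      ✱ (var (c̃ (idx i) (idx j)) ⊕ eij) ↦nil)
            es)

-- The pure part of A″ fixes c₀ = m and b = m + 3, so the bounds on a variable say exactly
-- that it holds a colour code m + 1, m + 2 or m + 3, and the heap of A″ consists of the three
-- cells m + e_ij + 1, 2, 3 for every edge; up to a constant, e_ij + ℓ is the base-n number
-- with digits i, j, ℓ − 1, so these blocks are pairwise disjoint.  A spatial formula holds in
-- a heap exactly when the addresses of its cells are pairwise distinct and the heap consists
-- of precisely those cells.  Hence in a model of B″ the cells c_i + e_ij, c_j + e_ij and
-- c̃_ij + e_ij are distinct, so the colours of the vertices form a proper colouring, which
-- agrees with the leaves because the leaf variables are not quantified.  Conversely, colouring
-- the vertices by a proper extension and giving c̃_ij the third colour turns the cells of B″
-- into a permutation of those of A″.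

module Submission where

open import Defs
open import Data.Nat using (ℕ; zero; suc; _+_; _*_; _∸_; _≤_; _<_; s≤s; s≤s⁻¹; z≤n; NonZero; _<?_; _≤?_)
open import Data.Nat.Properties
  using (_≟_; suc-injective; +-assoc; +-cancelˡ-≡; +-cancelʳ-≡; +-cancelˡ-≤; +-monoʳ-≤; ≤-trans; <-≤-trans;
         <⇒≱; ≰⇒>; m≤m+n; m≤n⇒∃[o]m+o≡n; m+[n∸m]≡n; +-∸-assoc; ∸-monoˡ-≤; +-commutativeSemigroup)
open import Data.Nat.DivMod using (_/_; /-congˡ; +-distrib-/-∣ʳ; m<n⇒m/n≡0; m*n/n≡m)
open import Data.Nat.Divisibility using (n∣m*n)
open import Data.Nat.Tactic.RingSolver using (solve-∀)
open import Algebra.Properties.CommutativeSemigroup +-commutativeSemigroup using (xy∙z≈xz∙y)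
open import Data.Fin using (Fin; toℕ; fromℕ<; inject≤)
open import Data.Fin.Patterns using (0F; 1F; 2F)
open import Data.Fin.Properties using (toℕ-injective; toℕ<n; toℕ-fromℕ<; fromℕ<-toℕ; toℕ-inject≤)
open import Data.List using (List; []; _∷_; _++_; map; concatMap; applyUpTo; upTo; drop; allFin)
open import Data.List.Properties using (map-upTo)
open import Data.List.Extrema.Nat using (max; xs≤max)
open import Data.List.Membership.Propositional using (_∈_; _∉_)
open import Data.List.Membership.Propositional.Properties
  using (∈-++⁻; ∈-++⁺ˡ; ∈-++⁺ʳ; ∈-map⁺; ∈-map⁻; ∈-concat⁻′; ∈-applyUpTo⁺; ∈-applyUpTo⁻)
open import Data.List.Membership.DecPropositional _≟_ using () renaming (_∈?_ to _∈ℕ?_)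
open import Data.List.Relation.Unary.Any using (here; there)
open import Data.List.Relation.Unary.All as All using (All; []; _∷_)
import Data.List.Relation.Unary.All.Properties as All
open import Data.List.Relation.Unary.AllPairs using ([]; _∷_)
open import Data.List.Relation.Unary.Unique.Propositional using (Unique)
import Data.List.Relation.Unary.Unique.Propositional.Properties as Unique
open import Data.List.Relation.Binary.Disjoint.Propositional using (Disjoint)
open import Data.List.Relation.Binary.Permutation.Propositional
  using (_↭_; ↭-sym; prep; swap; ↭⇒↭ₛ) renaming (refl to ↭-refl; trans to ↭-trans)
import Data.List.Relation.Binary.Permutation.Propositional.Properties as ↭
open import Data.Maybe using (Maybe; just; nothing)
open import Data.Maybe.Properties using (just-injective)
open import Data.Product using (∃; _×_; _,_; -,_; proj₁; proj₂)
open import Data.Sum using (_⊎_; inj₁; inj₂)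
open import Function using (_∘_; id; case_of_)
open import Function.Bundles using (_⇔_; mk⇔; Equivalence)
open import Relation.Nullary using (¬_; Dec; yes; no; contradiction; map′; _×-dec_)
open import Relation.Binary.Definitions using (DecidableEquality)
open import Relation.Binary.PropositionalEquality
open import Data.List.Relation.Binary.Permutation.Setoid.Properties (setoid ℕ) using (Unique-resp-↭)

open Equivalence using (to; from)

private
  variable
    A : Set
    m n k p a d : ℕ
    L L₁ L₂ L′ : List ℕ
    s : Stack
    h : Heap
    F : Spatial

cellsAt : List ℕ → ℕ → Maybe Val
cellsAt L a with a ∈ℕ? L
... | yes _ = just nil
... | no  _ = nothing

cellsAt-∈ : ∀ L → a ∈ L → cellsAt L a ≡ just nil
cellsAt-∈ {a} L a∈L with a ∈ℕ? L
... | yes _   = refl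
... | no  a∉L = contradiction a∈L a∉L

cellsAt-∉ : ∀ L → a ∉ L → cellsAt L a ≡ nothing
cellsAt-∉ {a} L a∉L with a ∈ℕ? L
... | yes a∈L = contradiction a∈L a∉L
... | no  _   = refl

cellsAt-resp : (a ∈ L → a ∈ L′) → (a ∈ L′ → a ∈ L) → cellsAt L a ≡ cellsAt L′ a
cellsAt-resp {a} {L} ∈L⇒∈L′ ∈L′⇒∈L with a ∈ℕ? L
... | yes a∈L = sym (cellsAt-∈ _ (∈L⇒∈L′ a∈L))
... | no  a∉L = sym (cellsAt-∉ _ (a∉L ∘ ∈L′⇒∈L))

cellsAt-++ˡ : ∀ L₁ → a ∉ L₂ → cellsAt (L₁ ++ L₂) a ≡ cellsAt L₁ a
cellsAt-++ˡ L₁ a∉L₂ = cellsAt-resp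
  (λ a∈ → case ∈-++⁻ L₁ a∈ of λ { (inj₁ a∈L₁) → a∈L₁ ; (inj₂ a∈L₂) → contradiction a∈L₂ a∉L₂ })
  ∈-++⁺ˡ

cellsAt-++ʳ : ∀ L₁ → a ∉ L₁ → cellsAt (L₁ ++ L₂) a ≡ cellsAt L₂ a
cellsAt-++ʳ L₁ a∉L₁ = cellsAt-resp
  (λ a∈ → case ∈-++⁻ L₁ a∈ of λ { (inj₁ a∈L₁) → contradiction a∈L₁ a∉L₁ ; (inj₂ a∈L₂) → a∈L₂ })
  (∈-++⁺ʳ L₁)

cellsAt-↭ : L ↭ L′ → cellsAt L a ≡ cellsAt L′ a
cellsAt-↭ L↭L′ = cellsAt-resp (↭.∈-resp-↭ L↭L′) (↭.∈-resp-↭ (↭-sym L↭L′))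

cellHeap : List ℕ → Heap
cellHeap L = record { fun = cellsAt L ; finite = suc (max 0 L) , beyond-max }
  where
  beyond-max : ∀ a → suc (max 0 L) ≤ a → cellsAt L a ≡ nothing
  beyond-max a max<a = cellsAt-∉ L λ a∈L → <⇒≱ max<a (All.lookup (xs≤max 0 L) a∈L)

infix 4 _≈cells_
_≈cells_ : Heap → List ℕ → Set
h ≈cells L = ∀ a → fun h a ≡ cellsAt L a

≈cells-nothing⇒∉ : ∀ L → h ≈cells L → fun h a ≡ nothing → a ∉ L
≈cells-nothing⇒∉ {h} {a} L h≈L h[a]≡nothing a∈L
  with trans (sym h[a]≡nothing) (trans (h≈L a) (cellsAt-∈ L a∈L))
... | ()

Unique-++⁻ : ∀ L₁ → Unique (L₁ ++ L₂) → Unique L₁ × Unique L₂ × Disjoint L₁ L₂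
Unique-++⁻ []        u          = [] , u , λ ()
Unique-++⁻ (x ∷ L₁) (x∉ ∷ u) with Unique-++⁻ L₁ u
... | u₁ , u₂ , L₁#L₂ = All.++⁻ˡ L₁ x∉ ∷ u₁ , u₂ , disjoint
  where
  disjoint : Disjoint (x ∷ L₁) _
  disjoint (here refl , x∈L₂) = All.lookup (All.++⁻ʳ L₁ x∉) x∈L₂ refl
  disjoint (there a∈L₁ , a∈L₂) = L₁#L₂ (a∈L₁ , a∈L₂)

-- Every spatial formula is a star of nil-cells; Cells s F L lists their addresses under s,
-- repetitions included.
data Cells (s : Stack) : Spatial → List ℕ → Set where
  emp   : Cells s emp []
  _↦nil : ∀ {t a} → eval s t ≡ just (num a) → Cells s (t ↦nil) (a ∷ [])
  _✱_   : ∀ {F₁ F₂ L₁ L₂} → Cells s F₁ L₁ → Cells s F₂ L₂ → Cells s (F₁ ✱ F₂) (L₁ ++ L₂)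

cells-sound : Cells s F L → Unique L → h ≈cells L → ⊨F s h F
cells-sound emp _ h≈L a = h≈L a
cells-sound (_↦nil {a = a} ev) _ h≈L =
  a , ev , trans (h≈L a) (cellsAt-∈ (a ∷ []) (here refl)) ,
  λ a′ a′≢a → trans (h≈L a′) (cellsAt-∉ (a ∷ []) λ { (here a′≡a) → a′≢a a′≡a })
cells-sound {h = h} (_✱_ {L₁ = L₁} {L₂} C₁ C₂) u h≈L with Unique-++⁻ L₁ u
... | u₁ , u₂ , L₁#L₂ =
  cellHeap L₁ , cellHeap L₂ , split , cells-sound C₁ u₁ (λ _ → refl) , cells-sound C₂ u₂ (λ _ → refl)
  where
  split : Split h (cellHeap L₁) (cellHeap L₂)
  split a = by-membership (a ∈ℕ? L₂)
    where
    by-membership : Dec (a ∈ L₂) → _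
    by-membership (no  a∉L₂) = inj₁ (trans (h≈L a) (cellsAt-++ˡ L₁ a∉L₂) , cellsAt-∉ L₂ a∉L₂)
    by-membership (yes a∈L₂) = inj₂ (trans (h≈L a) (cellsAt-++ʳ L₁ a∉L₁) , cellsAt-∉ L₁ a∉L₁)
      where a∉L₁ = λ a∈L₁ → L₁#L₂ (a∈L₁ , a∈L₂)

cells-complete : Cells s F L → ⊨F s h F → Unique L × h ≈cells L
cells-complete emp h⊨emp = [] , h⊨emp
cells-complete {h = h} (ev ↦nil) (a , ev′ , h[a]≡nil , elsewhere) with refl ← trans (sym ev) ev′ =
  ([] ∷ []) , pointwise
  where
  pointwise : h ≈cells (a ∷ [])
  pointwise a′ = by-equality (a′ ≟ a)
    where
    by-equality : Dec (a′ ≡ a) → fun h a′ ≡ cellsAt (a ∷ []) a′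
    by-equality (yes refl) = trans h[a]≡nil (sym (cellsAt-∈ (a ∷ []) (here refl)))
    by-equality (no  a′≢a) = trans (elsewhere a′ a′≢a) (sym (cellsAt-∉ (a ∷ []) λ { (here a′≡a) → a′≢a a′≡a }))
cells-complete {h = h} (_✱_ {L₁ = L₁} {L₂} C₁ C₂) (h₁ , h₂ , split , h₁⊨ , h₂⊨)
  with cells-complete C₁ h₁⊨ | cells-complete C₂ h₂⊨
... | u₁ , h₁≈L₁ | u₂ , h₂≈L₂ = Unique.++⁺ u₁ u₂ disjoint , pointwise
  where
  disjoint : Disjoint L₁ L₂
  disjoint {a} (a∈L₁ , a∈L₂) with split a
  ... | inj₁ (_ , h₂[a]≡nothing) = ≈cells-nothing⇒∉ {h₂} L₂ h₂≈L₂ h₂[a]≡nothing a∈L₂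
  ... | inj₂ (_ , h₁[a]≡nothing) = ≈cells-nothing⇒∉ {h₁} L₁ h₁≈L₁ h₁[a]≡nothing a∈L₁
  pointwise : h ≈cells (L₁ ++ L₂)
  pointwise a with split a
  ... | inj₁ (h[a]≡h₁[a] , h₂[a]≡nothing) =
    trans h[a]≡h₁[a] (trans (h₁≈L₁ a) (sym (cellsAt-++ˡ L₁ (≈cells-nothing⇒∉ {h₂} L₂ h₂≈L₂ h₂[a]≡nothing))))
  ... | inj₂ (h[a]≡h₂[a] , h₁[a]≡nothing) =
    trans h[a]≡h₂[a] (trans (h₂≈L₂ a) (sym (cellsAt-++ʳ L₁ (≈cells-nothing⇒∉ {h₁} L₁ h₁≈L₁ h₁[a]≡nothing))))

⊨F⇔cells : Cells s F L → ⊨F s h F ⇔ (Unique L × h ≈cells L)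
⊨F⇔cells C = mk⇔ (cells-complete C) (λ (u , h≈L) → cells-sound C u h≈L)

⊨⊛⇒⊨∈ : ∀ {Fs} → F ∈ Fs → ⊨F s h (⊛ Fs) → ∃ λ h′ → ⊨F s h′ F
⊨⊛⇒⊨∈ (here refl) (h₁ , _ , _ , h₁⊨ , _) = h₁ , h₁⊨
⊨⊛⇒⊨∈ (there F∈Fs) (_ , _ , _ , _ , h₂⊨) = ⊨⊛⇒⊨∈ F∈Fs h₂⊨

encode : ℕ → Fin 3 → ℕ
encode m x = m + suc (toℕ x)

encode-injective : ∀ {x y} → encode m x ≡ encode m y → x ≡ y
encode-injective {m} = toℕ-injective ∘ suc-injective ∘ +-cancelˡ-≡ m _ _

encode-bounded : ∀ x → m + 1 ≤ encode m x × encode m x ≤ m + 3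
encode-bounded {m} x = +-monoʳ-≤ m (s≤s z≤n) , +-monoʳ-≤ m (toℕ<n x)

bounded⇒encode : m + 1 ≤ d → d ≤ m + 3 → ∃ λ x → d ≡ encode m x
bounded⇒encode {m} m+1≤d d≤m+3 with m≤n⇒∃[o]m+o≡n (≤-trans (m≤m+n m 1) m+1≤d)
... | zero  , refl = contradiction (+-cancelˡ-≤ m 1 0 m+1≤d) λ ()
... | suc o , refl = fromℕ< o<3 , cong (λ i → m + suc i) (sym (toℕ-fromℕ< o<3))
  where o<3 = +-cancelˡ-≤ m _ _ d≤m+3

num-injective : num m ≡ num n → m ≡ n
num-injective refl = refl

Palette : Stack → ℕ → Set
Palette s m = s (c 0) ≡ num m × s b ≡ num (m + 3)

Coloured : Stack → ℕ → GVar → Set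
Coloured s m x = ∃ λ y → s x ≡ num (encode m y)

⊨bounds⇔coloured : ∀ {x} → Palette s m → All (⊨A s) (bounds (var x)) ⇔ Coloured s m x
⊨bounds⇔coloured {s} {m} {x} (s[c₀] , s[b]) = mk⇔ ⇒coloured coloured⇒
  where
  ⇒coloured : All (⊨A s) (bounds (var x)) → Coloured s m x
  ⇒coloured ((_ , d , ev₁ , evₓ , m+1≤d) ∷ (_ , _ , evₓ′ , ev-b , d≤m+3) ∷ [])
    rewrite s[c₀] | s[b] with refl ← ev₁ | refl ← ev-b | refl ← trans (sym evₓ) evₓ′ =
    let y , d≡ = bounded⇒encode m+1≤d d≤m+3 in y , trans (just-injective evₓ) (cong num d≡)
  coloured⇒ : Coloured s m x → All (⊨A s) (bounds (var x))
  coloured⇒ (y , s[x]) =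
    (m + 1 , encode m y , cong (λ v → addV (just v) 1) s[c₀] , cong just s[x] , proj₁ (encode-bounded y)) ∷
    (encode m y , m + 3 , cong just s[x] , cong just s[b] , proj₂ (encode-bounded y)) ∷ []

All-concatMap⇔ : ∀ {B : Set} {P : B → Set} (f : A → List B) xs →
                 All P (concatMap f xs) ⇔ All (All P ∘ f) xs
All-concatMap⇔ f xs = mk⇔ (All.map⁻ ∘ All.concat⁻) (All.concat⁺ ∘ All.map⁺)

All-vertices⇔ : ∀ {P : ℕ → Set} n → All P (map suc (upTo n)) ⇔ (∀ (i : Fin n) → P (idx i))
All-vertices⇔ {P} n = mk⇔
  (λ all i → All.applyUpTo⁻ id n (All.map⁻ all) (toℕ<n i))
  (λ P[idx] → All.map⁺ (All.applyUpTo⁺₁ id n λ p<n → subst (P ∘ suc) (toℕ-fromℕ< p<n) (P[idx] (fromℕ< p<n))))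

⊨bounds-concatMap⇔ : Palette s m → (g : A → GVar) (xs : List A) →
                     ⊨Π s (concatMap (λ x → bounds (var (g x))) xs) ⇔ All (Coloured s m ∘ g) xs
⊨bounds-concatMap⇔ palette g xs = mk⇔
  (All.map (to (⊨bounds⇔coloured palette)) ∘ to (All-concatMap⇔ _ xs))
  (from (All-concatMap⇔ _ xs) ∘ All.map (from (⊨bounds⇔coloured palette)))

⊨vertexBounds⇔ : Palette s m → ∀ n →
                 ⊨Π s (concatMap (λ i → bounds (var (c i))) (map suc (upTo n))) ⇔
                 (∀ (i : Fin n) → Coloured s m (c (idx i)))
⊨vertexBounds⇔ palette n = mk⇔
  (to (All-vertices⇔ n) ∘ to (⊨bounds-concatMap⇔ palette c _))
  (from (⊨bounds-concatMap⇔ palette c _) ∘ from (All-vertices⇔ n))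

⊨edgeBounds⇔ : Palette s m → (es : Edges n) →
               ⊨Π s (concatMap (λ e → bounds (var (c̃ (idx (proj₁ e)) (idx (proj₂ e))))) es) ⇔
               (∀ {i j} → (i , j) ∈ es → Coloured s m (c̃ (idx i) (idx j)))
⊨edgeBounds⇔ palette es = mk⇔
  (λ all {_} {_} ij∈es → All.lookup (to (⊨bounds-concatMap⇔ palette _ es) all) ij∈es)
  (λ coloured → from (⊨bounds-concatMap⇔ palette _ es) (All.tabulate λ {e} e∈es → coloured e∈es))

third : Fin 3 → Fin 3 → Fin 3
third 0F 1F = 2F
third 0F 2F = 1F
third 1F 0F = 2F
third 1F 2F = 0F
third 2F 0F = 1F
third 2F 1F = 0F
third _  _  = 0F

third-↭ : ∀ {x y} → x ≢ y → x ∷ y ∷ third x y ∷ [] ↭ allFin 3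
third-↭ {0F} {0F} x≢y = contradiction refl x≢y
third-↭ {1F} {1F} x≢y = contradiction refl x≢y
third-↭ {2F} {2F} x≢y = contradiction refl x≢y
third-↭ {0F} {1F} _ = ↭-refl
third-↭ {0F} {2F} _ = prep _ (swap _ _ ↭-refl)
third-↭ {1F} {0F} _ = swap _ _ ↭-refl
third-↭ {1F} {2F} _ = ↭-trans (prep _ (swap _ _ ↭-refl)) (swap _ _ ↭-refl)
third-↭ {2F} {0F} _ = ↭-trans (swap _ _ ↭-refl) (prep _ (swap _ _ ↭-refl))
third-↭ {2F} {1F} _ = ↭-trans (swap _ _ ↭-refl) (↭-trans (prep _ (swap _ _ ↭-refl)) (swap _ _ ↭-refl))

quotient-unique : ∀ d .{{_ : NonZero d}} {q r} → r < d → (r + q * d) / d ≡ q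
quotient-unique d {q} {r} r<d = begin
  (r + q * d) / d    ≡⟨ +-distrib-/-∣ʳ r (n∣m*n q) ⟩
  r / d + q * d / d  ≡⟨ cong₂ _+_ (m<n⇒m/n≡0 r<d) (m*n/n≡m q d) ⟩
  q                  ∎
  where open ≡-Reasoning

+-*-injective : ∀ d .{{_ : NonZero d}} {q q′ r r′} → r < d → r′ < d →
                r + q * d ≡ r′ + q′ * d → r ≡ r′ × q ≡ q′
+-*-injective d {q} {q′} {r} {r′} r<d r′<d eq =
  +-cancelʳ-≡ (q * d) r r′ (subst (λ z → r + q * d ≡ r′ + z * d) (sym q≡q′) eq) , q≡q′
  where
  q≡q′ : q ≡ q′
  q≡q′ = trans (sym (quotient-unique d r<d)) (trans (/-congˡ eq) (quotient-unique d r′<d))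

-- e_ij + ℓ written in base n, up to a constant
eIdx-digits : ∀ n i j t → suc i * (n * n) + suc j * n + suc t ≡ (t + (j + i * n) * n) + suc (n + n * n)
eIdx-digits = solve-∀

slot : ℕ → ℕ → Fin 3 → ℕ
slot m e x = m + e + suc (toℕ x)

slot-injective : ∀ {e x y} → slot m e x ≡ slot m e y → x ≡ y
slot-injective {m} {e} = toℕ-injective ∘ suc-injective ∘ +-cancelˡ-≡ (m + e) _ _

encode-+ : ∀ e x → encode m x + e ≡ slot m e x
encode-+ {m} e x = xy∙z≈xz∙y m (suc (toℕ x)) e

slot-eIdx-injective : ∀ {n} .{{_ : NonZero n}} {i j i′ j′ : Fin n} {x y} → 3 ≤ n →
                      slot m (eIdx n i j) x ≡ slot m (eIdx n i′ j′) y → i ≡ i′ × j ≡ j′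
slot-eIdx-injective {m} {n} {i} {j} {i′} {j′} {x} {y} 3≤n eq =
  toℕ-injective (proj₂ vertices) , toℕ-injective (proj₁ vertices)
  where
  open ≡-Reasoning
  in-base-n : toℕ x + (toℕ j + toℕ i * n) * n ≡ toℕ y + (toℕ j′ + toℕ i′ * n) * n
  in-base-n = +-cancelʳ-≡ _ _ _ (begin
    toℕ x + (toℕ j + toℕ i * n) * n + suc (n + n * n)    ≡⟨ eIdx-digits n (toℕ i) (toℕ j) (toℕ x) ⟨
    eIdx n i j + suc (toℕ x)                             ≡⟨ +-cancelˡ-≡ m _ _ (trans (sym (+-assoc m _ _)) (trans eq (+-assoc m _ _))) ⟩
    eIdx n i′ j′ + suc (toℕ y)                           ≡⟨ eIdx-digits n (toℕ i′) (toℕ j′) (toℕ y) ⟩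
    toℕ y + (toℕ j′ + toℕ i′ * n) * n + suc (n + n * n)  ∎)
  vertices : toℕ j ≡ toℕ j′ × toℕ i ≡ toℕ i′
  vertices = +-*-injective n (toℕ<n j) (toℕ<n j′)
               (proj₂ (+-*-injective n (<-≤-trans (toℕ<n x) 3≤n) (<-≤-trans (toℕ<n y) 3≤n) in-base-n))

edgeCells : ℕ → Fin n × Fin n → List ℕ
edgeCells {n} m (i , j) = map (slot m (eIdx n i j)) (allFin 3)

edgeCells-unique : ∀ m (e : Fin n × Fin n) → Unique (edgeCells m e)
edgeCells-unique {n} m (i , j) = Unique.map⁺ (slot-injective {m} {eIdx n i j}) (Unique.allFin⁺ 3)

-- For n ≥ 3 distinct ordered pairs get disjoint cells; for n = 2 the cells of
-- (v₁,v₂) and (v₂,v₁) overlap, which is why both orientations must be excluded.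
edgeCells-disjoint : ∀ {n} m {i j i′ j′ : Fin n} → i ≢ j → i′ ≢ j′ →
                     ¬ (i ≡ i′ × j ≡ j′) → ¬ (i ≡ j′ × j ≡ i′) →
                     Disjoint (edgeCells m (i , j)) (edgeCells m (i′ , j′))
edgeCells-disjoint {1} m {0F} {0F} i≢j _ _ _ = contradiction refl i≢j
edgeCells-disjoint {2} m {0F} {0F} i≢j _ _ _ = contradiction refl i≢j
edgeCells-disjoint {2} m {1F} {1F} i≢j _ _ _ = contradiction refl i≢j
edgeCells-disjoint {2} m {_} {_} {0F} {0F} _ i′≢j′ _ _ = contradiction refl i′≢j′
edgeCells-disjoint {2} m {_} {_} {1F} {1F} _ i′≢j′ _ _ = contradiction refl i′≢j′
edgeCells-disjoint {2} m {0F} {1F} {0F} {1F} _ _ ≢same _ = contradiction (refl , refl) ≢same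
edgeCells-disjoint {2} m {1F} {0F} {1F} {0F} _ _ ≢same _ = contradiction (refl , refl) ≢same
edgeCells-disjoint {2} m {0F} {1F} {1F} {0F} _ _ _ ≢flip = contradiction (refl , refl) ≢flip
edgeCells-disjoint {2} m {1F} {0F} {0F} {1F} _ _ _ ≢flip = contradiction (refl , refl) ≢flip
edgeCells-disjoint {n@(suc (suc (suc _)))} m {i} {j} {i′} {j′} _ _ ≢same _ (v∈ , v∈′)
  with _ , _ , refl ← ∈-map⁻ (slot m (eIdx n i j)) v∈ | _ , _ , v≡ ← ∈-map⁻ (slot m (eIdx n i′ j′)) v∈′ =
  ≢same (slot-eIdx-injective (s≤s (s≤s (s≤s z≤n))) v≡)

allEdgeCells-unique : ∀ m (es : Edges n) → Loopless es → NoMultiEdges es →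
                      Unique (concatMap (edgeCells m) es)
allEdgeCells-unique m [] [] [] = []
allEdgeCells-unique m ((i , j) ∷ es) (i≢j ∷ loopless) (distinct ∷ no-multi) =
  Unique.++⁺ (edgeCells-unique m (i , j)) (allEdgeCells-unique m es loopless no-multi) disjoint
  where
  disjoint : Disjoint (edgeCells m (i , j)) (concatMap (edgeCells m) es)
  disjoint (v∈ , v∈es) with _ , v∈′ , cells∈ ← ∈-concat⁻′ (map (edgeCells m) es) v∈es
                           with e′ , e′∈es , refl ← ∈-map⁻ (edgeCells m) cells∈ =
    edgeCells-disjoint m i≢j (All.lookup loopless e′∈es)
      (proj₁ (All.lookup distinct e′∈es)) (proj₂ (All.lookup distinct e′∈es)) (v∈ , v∈′)

A″-cells : ∀ {m} → s (c 0) ≡ num m → (es : Edges n) →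
           Cells s (SH.spatial (A″ n k es)) (concatMap (edgeCells m) es)
A″-cells s[c₀] [] = emp
A″-cells {s} {n} {k} {m} s[c₀] ((i , j) ∷ es) =
  at 0F ↦nil ✱ (at 1F ↦nil ✱ (at 2F ↦nil ✱ A″-cells {k = k} s[c₀] es))
  where
  at : ∀ x → eval s ((c₀ ⊕ eIdx n i j) ⊕ suc (toℕ x)) ≡ just (num (slot m (eIdx n i j) x))
  at x = cong (λ v → addV (addV (just v) (eIdx n i j)) (suc (toℕ x))) s[c₀]

-- Written with projections so that ⊛ (map (gadget n) es) is definitionally the spatial part of B″.
gadget : (n : ℕ) → Fin n × Fin n → Spatial
gadget n e = let i = proj₁ e ; j = proj₂ e ; eij = eIdx n i j in
             ((var (c (idx i)) ⊕ eij) ↦nil ✱ (var (c (idx j)) ⊕ eij) ↦nil) ✱ (var (c̃ (idx i) (idx j)) ⊕ eij) ↦nil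

gadget-cells : ∀ {m i j x y z} →
               s (c (idx i)) ≡ num (encode m x) → s (c (idx j)) ≡ num (encode m y) →
               s (c̃ (idx i) (idx j)) ≡ num (encode m z) →
               Cells s (gadget n (i , j)) (map (slot m (eIdx n i j)) (x ∷ y ∷ z ∷ []))
gadget-cells {s} {n} {m} {i} {j} s[i] s[j] s[ij] = (at s[i] ↦nil ✱ at s[j] ↦nil) ✱ at s[ij] ↦nil
  where
  at : ∀ {v w} → s v ≡ num (encode m w) → eval s (var v ⊕ eIdx n i j) ≡ just (num (slot m (eIdx n i j) w))
  at {w = w} s[v] = trans (cong (λ u → addV (just u) (eIdx n i j)) s[v]) (cong (just ∘ num) (encode-+ {m} (eIdx n i j) w))

Proper : Edges n → (Fin n → Fin 3) → Set
Proper es col = ∀ {i j} → (i , j) ∈ es → col i ≢ col j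

gadgetCells : ℕ → (Fin n → Fin 3) → Fin n × Fin n → List ℕ
gadgetCells {n} m col (i , j) = map (slot m (eIdx n i j)) (col i ∷ col j ∷ third (col i) (col j) ∷ [])

B″-cells : ∀ {m} {col : Fin n → Fin 3} → (∀ i → s (c (idx i)) ≡ num (encode m (col i))) → (es : Edges n) →
           (∀ {i j} → (i , j) ∈ es → s (c̃ (idx i) (idx j)) ≡ num (encode m (third (col i) (col j)))) →
           Cells s (SH.spatial (B″ n k es)) (concatMap (gadgetCells m col) es)
B″-cells s[vertex] []             s[edge] = emp
B″-cells {k = k} s[vertex] ((i , j) ∷ es) s[edge] =
  gadget-cells (s[vertex] i) (s[vertex] j) (s[edge] (here refl)) ✱ B″-cells {k = k} s[vertex] es (s[edge] ∘ there)

gadgetCells-↭ : ∀ m {col} (es : Edges n) → Proper es col →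
                concatMap (gadgetCells m col) es ↭ concatMap (edgeCells m) es
gadgetCells-↭ m []             proper = ↭-refl
gadgetCells-↭ {n} m ((i , j) ∷ es) proper =
  ↭.++⁺ (↭.map⁺ (slot m (eIdx n i j)) (third-↭ (proper (here refl)))) (gadgetCells-↭ m es (proper ∘ there))

drop-applyUpTo : ∀ k n (f : ℕ → A) → drop k (applyUpTo f n) ≡ applyUpTo (f ∘ (k +_)) (n ∸ k)
drop-applyUpTo zero    n       f = refl
drop-applyUpTo (suc k) zero    f = refl
drop-applyUpTo (suc k) (suc n) f = drop-applyUpTo k n (f ∘ suc)

drop-vertices : ∀ k n → drop k (map suc (upTo n)) ≡ applyUpTo (suc ∘ (k +_)) (n ∸ k)
drop-vertices k n = trans (cong (drop k) (map-upTo suc n)) (drop-applyUpTo k n suc)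

∈-exVars-c⁻ : ∀ {es : Edges n} → c p ∈ SH.exVars (B″ n k es) → k < p
∈-exVars-c⁻ {n} {k = k} c∈ with ∈-++⁻ (map c (drop k (map suc (upTo n)))) c∈
... | inj₂ c∈c̃s with _ , _ , () ← ∈-map⁻ _ c∈c̃s
... | inj₁ c∈cs with p , p∈ , refl ← ∈-map⁻ c c∈cs
                with i , _ , refl ← ∈-applyUpTo⁻ _ (subst (p ∈_) (drop-vertices k n) p∈) = s≤s (m≤m+n k i)

∈-exVars-c⁺ : ∀ {es : Edges n} → k ≤ p → p < n → c (suc p) ∈ SH.exVars (B″ n k es)
∈-exVars-c⁺ {n} {k} {p} k≤p p<n =
  ∈-++⁺ˡ (∈-map⁺ c (subst (suc p ∈_) (sym (drop-vertices k n)) suc[p]∈))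
  where
  suc[p]∈ : suc p ∈ applyUpTo (suc ∘ (k +_)) (n ∸ k)
  suc[p]∈ = subst (λ q → suc q ∈ _) (m+[n∸m]≡n k≤p)
              (∈-applyUpTo⁺ (suc ∘ (k +_)) (subst (_≤ n ∸ k) (+-∸-assoc 1 k≤p) (∸-monoˡ-≤ k p<n)))

∈-exVars-c̃ : ∀ {es : Edges n} {i j} → (i , j) ∈ es → c̃ (idx i) (idx j) ∈ SH.exVars (B″ n k es)
∈-exVars-c̃ {n} {k} ij∈es = ∈-++⁺ʳ (map c (drop k (map suc (upTo n)))) (∈-map⁺ _ ij∈es)

b∉exVars : ∀ {es : Edges n} → b ∉ SH.exVars (B″ n k es)
b∉exVars {n} {k} b∈ with ∈-++⁻ (map c (drop k (map suc (upTo n)))) b∈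
... | inj₁ b∈cs  with _ , _ , () ← ∈-map⁻ c b∈cs
... | inj₂ b∈c̃s with _ , _ , () ← ∈-map⁻ _ b∈c̃s

_≟ᵛ_ : DecidableEquality GVar
c p     ≟ᵛ c q      = map′ (cong c) (λ { refl → refl }) (p ≟ q)
b       ≟ᵛ b        = yes refl
c̃ p q   ≟ᵛ c̃ p′ q′ = map′ (λ (p≡p′ , q≡q′) → cong₂ c̃ p≡p′ q≡q′) (λ { refl → refl , refl }) (p ≟ p′ ×-dec q ≟ q′)
c _     ≟ᵛ b        = no λ ()
c _     ≟ᵛ c̃ _ _   = no λ ()
b       ≟ᵛ c _      = no λ ()
b       ≟ᵛ c̃ _ _   = no λ ()
c̃ _ _   ≟ᵛ c _      = no λ ()
c̃ _ _   ≟ᵛ b        = no λ ()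

open import Data.List.Membership.DecPropositional _≟ᵛ_ using () renaming (_∈?_ to _∈ᵛ?_)

override : List GVar → Stack → Stack → Stack
override zs s′ s x with x ∈ᵛ? zs
... | yes _ = s′ x
... | no  _ = s x

override-∈ : ∀ {zs s′ x} → x ∈ zs → override zs s′ s x ≡ s′ x
override-∈ {zs = zs} {x = x} x∈ with x ∈ᵛ? zs
... | yes _  = refl
... | no x∉ = contradiction x∈ x∉

override-∉ : ∀ {zs s′ x} → x ∉ zs → override zs s′ s x ≡ s x
override-∉ {zs = zs} {x = x} x∉ with x ∈ᵛ? zs
... | yes x∈ = contradiction x∈ x∉
... | no  _  = refl

c₀∉exVars : ∀ {es : Edges n} → c 0 ∉ SH.exVars (B″ n k es)
c₀∉exVars {n} {k} {es} c₀∈ with () ← ∈-exVars-c⁻ {n} {k = k} {es = es} c₀∈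

leaf∉exVars : ∀ {es : Edges n} (k≤n : k ≤ n) (l : Fin k) → c (idx (inject≤ l k≤n)) ∉ SH.exVars (B″ n k es)
leaf∉exVars {n} {k} {es} k≤n l c∈ =
  <⇒≱ (toℕ<n l) (subst (k ≤_) (toℕ-inject≤ l k≤n) (s≤s⁻¹ (∈-exVars-c⁻ {n} {k = k} {es = es} c∈)))

leaf-or-exVar : ∀ {es : Edges n} (k≤n : k ≤ n) (i : Fin n) →
                (∃ λ l → inject≤ l k≤n ≡ i) ⊎ c (idx i) ∈ SH.exVars (B″ n k es)
leaf-or-exVar {n} {k} {es} k≤n i with k ≤? toℕ i
... | yes k≤i = inj₂ (∈-exVars-c⁺ {es = es} k≤i (toℕ<n i))
... | no  k≰i = inj₁ (fromℕ< i<k , toℕ-injective (trans (toℕ-inject≤ _ k≤n) (toℕ-fromℕ< i<k)))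
  where i<k = ≰⇒> k≰i

colourAt : (Fin n → Fin 3) → ℕ → Fin 3
colourAt {n} col p with p <? n
... | yes p<n = col (fromℕ< p<n)
... | no  _   = 0F

colourAt-toℕ : ∀ (col : Fin n → Fin 3) i → colourAt col (toℕ i) ≡ col i
colourAt-toℕ {n} col i with toℕ i <? n
... | yes i<n = cong col (fromℕ<-toℕ i i<n)
... | no  i≮n = contradiction (toℕ<n i) i≮n

colourStack : ℕ → (Fin n → Fin 3) → Stack
colourStack m col (c zero)              = num m
colourStack m col (c (suc p))           = num (encode m (colourAt col p))
colourStack m col b                     = num (m + 3)
colourStack m col (c̃ (suc p) (suc q))  = num (encode m (third (colourAt col p) (colourAt col q)))
colourStack m col (c̃ _ _)               = num m

colourStack-numeric : ∀ {m} {col : Fin n → Fin 3} x → ∃ λ v → colourStack m col x ≡ num v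
colourStack-numeric (c zero)             = -, refl
colourStack-numeric (c (suc _))          = -, refl
colourStack-numeric b                    = -, refl
colourStack-numeric (c̃ zero _)           = -, refl
colourStack-numeric (c̃ (suc _) zero)     = -, refl
colourStack-numeric (c̃ (suc _) (suc _))  = -, refl

colourStack-vertex : ∀ {m} (col : Fin n → Fin 3) i → colourStack m col (c (idx i)) ≡ num (encode m (col i))
colourStack-vertex {m = m} col i = cong (num ∘ encode m) (colourAt-toℕ col i)

colourStack-edge : ∀ {m} (col : Fin n → Fin 3) i j →
                   colourStack m col (c̃ (idx i) (idx j)) ≡ num (encode m (third (col i) (col j)))
colourStack-edge {m = m} col i j =
  cong₂ (λ x y → num (encode m (third x y))) (colourAt-toℕ col i) (colourAt-toℕ col j)

colourStack-leaf : ∀ {m} (k≤n : k ≤ n) (f : Fin k → Fin 3) l →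
                   colourStack m f (c (idx (inject≤ l k≤n))) ≡ num (encode m (f l))
colourStack-leaf {m = m} k≤n f l =
  trans (cong (num ∘ encode m ∘ colourAt f) (toℕ-inject≤ l k≤n)) (colourStack-vertex f l)

⊨b≐c₀+3⇒palette : ⊨A s (var b ≐ (c₀ ⊕ 3)) → ∃ λ m → Palette s m
⊨b≐c₀+3⇒palette {s} (v , ev-b , ev₀)
  with s (c 0) | ev₀
... | num m | refl = m , refl , just-injective ev-b
... | nil   | ()

A″-model : ∀ {es : Edges n} (f : Fin k → Fin 3) → Loopless es → NoMultiEdges es →
           ⊨SH (colourStack 0 f) (cellHeap (concatMap (edgeCells 0) es)) (A″ n k es)
A″-model {n} {k} {es} f loopless no-multi =
  colourStack 0 f , (λ _ _ → refl) , [] ,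
  (num 3 , refl , refl) ∷ from (⊨vertexBounds⇔ (refl , refl) k) (λ l → f l , colourStack-vertex {m = 0} f l) ,
  cells-sound (A″-cells {k = k} refl es) (allEdgeCells-unique 0 es loopless no-multi) (λ _ → refl)

B″-colouring : ∀ {es : Edges n} → Palette s m →
               ⊨Π s (SH.pure (B″ n k es)) → ⊨F s h (SH.spatial (B″ n k es)) →
               ∃ λ col → (∀ i → s (c (idx i)) ≡ num (encode m (col i))) × Proper es col
B″-colouring {n} {s} {m} {es = es} palette ⊨pure ⊨spatial = col , col-value , proper
  where
  vertex : ∀ i → Coloured s m (c (idx i))
  vertex = to (⊨vertexBounds⇔ palette n) (All.++⁻ˡ _ ⊨pure)
  edge : ∀ {i j} → (i , j) ∈ es → Coloured s m (c̃ (idx i) (idx j))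
  edge = to (⊨edgeBounds⇔ palette es) (All.++⁻ʳ _ ⊨pure)
  col : Fin n → Fin 3
  col i = proj₁ (vertex i)
  col-value : ∀ i → s (c (idx i)) ≡ num (encode m (col i))
  col-value i = proj₂ (vertex i)
  proper : Proper es col
  proper {i} {j} ij∈es col-i≡col-j
    with h′ , ⊨gadget ← ⊨⊛⇒⊨∈ (∈-map⁺ (gadget n) ij∈es) ⊨spatial
    with (aᵢ≢aⱼ ∷ _) ∷ _ , _ ← cells-complete {h = h′}
           (gadget-cells {s} {n} {m} {i} {j} (col-value i) (col-value j) (proj₂ (edge ij∈es))) ⊨gadget
    = aᵢ≢aⱼ (cong (slot m (eIdx n i j)) col-i≡col-j)

Extendable : k ≤ n → Edges n → Set
Extendable {k} {n} k≤n es = ∀ (f : Fin k → Fin 3) → ∃ λ (col : Fin n → Fin 3) →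
                              (∀ l → col (inject≤ l k≤n) ≡ f l) × Proper es col

entails⇒extendable : (k≤n : k ≤ n) (es : Edges n) → Loopless es → NoMultiEdges es →
                     A″ n k es ⊨ B″ n k es → Extendable k≤n es
entails⇒extendable {k} {n} k≤n es loopless no-multi entails f
  with s′ , s′≡s₀ , _ , ⊨pure , ⊨spatial
         ← entails (colourStack 0 f) (cellHeap (concatMap (edgeCells 0) es)) (A″-model f loopless no-multi)
  with col , col-value , proper
         ← B″-colouring {k = k} (s′≡s₀ (c 0) (c₀∉exVars {k = k} {es = es}) , s′≡s₀ b (b∉exVars {k = k} {es = es})) ⊨pure ⊨spatial
  = col , extends-f , proper
  where
  extends-f : ∀ l → col (inject≤ l k≤n) ≡ f l
  extends-f l = encode-injective {0} (num-injective (begin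
    num (encode 0 (col (inject≤ l k≤n)))       ≡⟨ col-value (inject≤ l k≤n) ⟨
    s′ (c (idx (inject≤ l k≤n)))               ≡⟨ s′≡s₀ _ (leaf∉exVars {es = es} k≤n l) ⟩
    colourStack 0 f (c (idx (inject≤ l k≤n)))  ≡⟨ colourStack-leaf {m = 0} k≤n f l ⟩
    num (encode 0 (f l))                       ∎))
    where open ≡-Reasoning

B″-model : ∀ {es : Edges n} {col : Fin n → Fin 3} (k≤n : k ≤ n) → Palette s m →
           (leaf : ∀ (l : Fin k) → Coloured s m (c (idx l))) → (∀ l → col (inject≤ l k≤n) ≡ proj₁ (leaf l)) →
           Proper es col → ⊨F s h (SH.spatial (A″ n k es)) → ⊨SH s h (B″ n k es)
B″-model {n} {k} {s} {m} {h} {es} {col} k≤n palette leaf extends proper ⊨A″-spatial =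
  s′ , (λ _ → s′-∉) , All.tabulate (λ {x} → numeric x) , ⊨pure , ⊨spatial
  where
  zs = SH.exVars (B″ n k es)
  s′ : Stack
  s′ = override zs (colourStack m col) s

  s′-∈ : ∀ {x} → x ∈ zs → s′ x ≡ colourStack m col x
  s′-∈ = override-∈ {s} {zs}

  s′-∉ : ∀ {x} → x ∉ zs → s′ x ≡ s x
  s′-∉ = override-∉ {s} {zs}

  numeric : ∀ x → x ∈ zs → ∃ λ v → s′ x ≡ num v
  numeric x x∈ = let v , eq = colourStack-numeric x in v , trans (s′-∈ x∈) eq

  palette′ : Palette s′ m
  palette′ = trans (s′-∉ (c₀∉exVars {k = k} {es = es})) (proj₁ palette) ,
             trans (s′-∉ (b∉exVars {k = k} {es = es})) (proj₂ palette)

  s′-vertex : ∀ i → s′ (c (idx i)) ≡ num (encode m (col i))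
  s′-vertex i with leaf-or-exVar {es = es} k≤n i
  ... | inj₂ c∈ = trans (s′-∈ c∈) (colourStack-vertex col i)
  ... | inj₁ (l , refl) = begin
    s′ (c (idx (inject≤ l k≤n)))          ≡⟨ s′-∉ (leaf∉exVars {es = es} k≤n l) ⟩
    s (c (suc (toℕ (inject≤ l k≤n))))     ≡⟨ cong (λ q → s (c (suc q))) (toℕ-inject≤ l k≤n) ⟩
    s (c (idx l))                         ≡⟨ proj₂ (leaf l) ⟩
    num (encode m (proj₁ (leaf l)))       ≡⟨ cong (num ∘ encode m) (extends l) ⟨
    num (encode m (col (inject≤ l k≤n)))  ∎
    where open ≡-Reasoning

  s′-edge : ∀ {i j} → (i , j) ∈ es → s′ (c̃ (idx i) (idx j)) ≡ num (encode m (third (col i) (col j)))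
  s′-edge {i} {j} ij∈es = trans (s′-∈ (∈-exVars-c̃ {k = k} ij∈es)) (colourStack-edge col i j)

  ⊨pure : ⊨Π s′ (SH.pure (B″ n k es))
  ⊨pure = All.++⁺ (from (⊨vertexBounds⇔ palette′ n) (λ i → col i , s′-vertex i))
                  (from (⊨edgeBounds⇔ palette′ es) (λ ij∈es → -, s′-edge ij∈es))

  cells↭ : concatMap (gadgetCells m col) es ↭ concatMap (edgeCells m) es
  cells↭ = gadgetCells-↭ m es proper

  ⊨spatial : ⊨F s′ h (SH.spatial (B″ n k es))
  ⊨spatial with unique , h≈cells ← to (⊨F⇔cells (A″-cells {s} {k = k} (proj₁ palette) es)) ⊨A″-spatial =
    from (⊨F⇔cells (B″-cells {k = k} s′-vertex es s′-edge))
      (Unique-resp-↭ (↭⇒↭ₛ (↭-sym cells↭)) unique , λ a → trans (h≈cells a) (cellsAt-↭ (↭-sym cells↭)))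

extendable⇒entails : (k≤n : k ≤ n) (es : Edges n) → Extendable k≤n es → A″ n k es ⊨ B″ n k es
extendable⇒entails {k} k≤n es extendable s h (s₁ , s₁≡s , _ , b≐c₀+3 ∷ ⊨leaves , ⊨A″-spatial)
  with m , palette ← ⊨b≐c₀+3⇒palette {s₁} b≐c₀+3
  with leaf ← to (⊨vertexBounds⇔ {s₁} palette k) ⊨leaves
  with col , extends , proper ← extendable (proj₁ ∘ leaf)
  with s₂ , s₂≡s₁ , numeric , ⊨pure , ⊨spatial ← B″-model k≤n palette leaf extends proper ⊨A″-spatial
  = s₂ , (λ x x∉ → trans (s₂≡s₁ x x∉) (s₁≡s x λ ())) , numeric , ⊨pure , ⊨spatial

lemma4 : (n k : ℕ) (k≤n : k ≤ n) (es : Edges n) → Loopless es → NoMultiEdges es →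
    ((A″ n k es ⊨ B″ n k es) ⇔
     (∀ (f : Fin k → Fin 3) → ∃ λ (col : Fin n → Fin 3) →
        (∀ i → col (inject≤ i k≤n) ≡ f i)
        × (∀ {i j} → (i , j) ∈ es → col i ≢ col j)))
lemma4 n k k≤n es loopless no-multi =
  mk⇔ (entails⇒extendable k≤n es loopless no-multi) (extendable⇒entails k≤n es)
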